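{- Let $a$ and $b$ be positive integers and let $(u_m)_{m\ge0}$ be defined by $u_0=0$, $u_1=1$ and $u_m=au_{m-1}+bu_{m-2}$ for $m\ge2$. Then for every positive integer $n$, $$Z\bigl(D_n(\underbrace{a,\dots,a}_{n};\underbrace{b,\dots,b}_{n-1})\bigr)=u_{n+1}.$$
   Context: For positive integers $x_1,\dots,x_n$ and $y_1,\dots,y_{n-1}$, the caterpillar-bond graph $D_n(x_1,\dots,x_n;y_1,\dots,y_{n-1})$ is the multigraph with a central path of vertices $v_1,\dots,v_n$, where for each $k=1,\dots,n-1$ the vertices $v_k$ and $v_{k+1}$ are joined by exactly $y_k$ parallel edges, and where each $v_k$ additionally has exactly $x_k-1$ pendant vertices attached to it by single edges; there are no other vertices or edges. For a finite multigraph $G$, the topological index (Hosoya index) is $Z(G)=\sum_{k\ge0}p(G,k)$, where $p(G,k)$ is the number of sets of $k$ pairwise disjoint edges of $G$ ($p(G,0)=1$), parallel edges being counted as distinct edges. -}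

module Defs where

open import Data.Nat using (ℕ; zero; suc; _+_; _*_; _∸_; _≡ᵇ_)
open import Data.Bool using (Bool; true; false; _∧_; not)
open import Data.List using (List; []; _∷_; _++_; map; concatMap; replicate; length; filter; upTo)
open import Data.Nat.ListAction using (sum)
open import Data.Product using (_×_; _,_)
open import Data.Sum using (_⊎_; inj₁; inj₂)
import Data.Sum.Properties as SumP
import Data.Product.Properties as ProdP
import Data.Nat.Properties as NatP
open import Relation.Binary.Definitions using (DecidableEquality)
open import Relation.Nullary.Decidable using (⌊_⌋)

-- Vertices: inj₁ k is the path vertex v_k; inj₂ (k , j) is the j-th pendant vertex of v_k.
Vtx : Set
Vtx = ℕ ⊎ (ℕ × ℕ)

_≟V_ : DecidableEquality Vtx
_≟V_ = SumP.≡-dec NatP._≟_ (ProdP.≡-dec NatP._≟_ NatP._≟_)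

Edge : Set
Edge = Vtx × Vtx

-- A finite multigraph, given by its list of edges; parallel edges are
-- distinct list entries and hence counted as distinct edges.
-- (Isolated vertices do not affect matchings, so they are omitted.)
MultiGraph : Set
MultiGraph = List Edge

disjointᵇ : Edge → Edge → Bool
disjointᵇ (p , q) (r , s) =
  not (⌊ p ≟V r ⌋) ∧ not (⌊ p ≟V s ⌋) ∧ not (⌊ q ≟V r ⌋) ∧ not (⌊ q ≟V s ⌋)

allᵇ : {A : Set} → (A → Bool) → List A → Bool
allᵇ f [] = true
allᵇ f (x ∷ xs) = f x ∧ allᵇ f xs

pairwiseDisjointᵇ : List Edge → Bool
pairwiseDisjointᵇ [] = true
pairwiseDisjointᵇ (e ∷ es) = allᵇ (disjointᵇ e) es ∧ pairwiseDisjointᵇ es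

-- all sub-collections of the edge list (chosen by position, so every subset
-- of the edge multiset indexed by positions appears exactly once)
subsets : {A : Set} → List A → List (List A)
subsets [] = [] ∷ []
subsets (x ∷ xs) = subsets xs ++ map (x ∷_) (subsets xs)

countᵇ : {A : Set} → (A → Bool) → List A → ℕ
countᵇ f [] = 0
countᵇ f (x ∷ xs) with f x
... | true = suc (countᵇ f xs)
... | false = countᵇ f xs

p : MultiGraph → ℕ → ℕ
p G k = countᵇ (λ S → (length S ≡ᵇ k) ∧ pairwiseDisjointᵇ S) (subsets G)

-- Hosoya index Z(G) = Σ_{k ≥ 0} p(G,k); p(G,k) = 0 for k > |E(G)|,
-- so the sum over k = 0 … |E(G)| is the full sum.
Z : MultiGraph → ℕ
Z G = sum (map (p G) (upTo (suc (length G))))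

range1 : ℕ → List ℕ
range1 m = map suc (upTo m)

-- Caterpillar-bond graph D_n(x_1,…,x_n ; y_1,…,y_{n-1}), with x k = x_k and
-- y k = y_k (only the values at k = 1..n resp. 1..n-1 are used).
-- v_k and v_{k+1} are joined by y_k parallel edges; v_k carries x_k - 1 pendant vertices.
D : (n : ℕ) → (ℕ → ℕ) → (ℕ → ℕ) → MultiGraph
D n x y =
  concatMap (λ k → replicate (y k) (inj₁ k , inj₁ (suc k))) (range1 (n ∸ 1))
  ++ concatMap (λ k → map (λ j → (inj₁ k , inj₂ (k , j))) (range1 (x k ∸ 1))) (range1 n)

u : ℕ → ℕ → ℕ → ℕ
u a b zero = 0
u a b (suc zero) = 1
u a b (suc (suc m)) = a * u a b (suc m) + b * u a b m

-- Write M(L) for the number of matchings (sub-collections of pairwise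
-- disjoint edges) of an edge list L.
--     It is derived from the same recursion for matchings restricted to an
--     arbitrary edge predicate, which commutes with filtering the edge list.
--  3. Two consequences: M is invariant under permutations of the edge list,
--     and a "star" L of edges through a common vertex, each of which deletes
--     the same neighbours from the rest R (leaving R'), satisfies
--     M(L ++ R) = M(R) + |L| · M(R').
--  4. The edge list of D_n is a permutation of P_1 B_1 P_2 B_2 … B_{n-1} P_n,
--     where P_s are the a-1 pendant edges at v_s and B_s the b bonds v_s v_{s+1}.
--     Peeling off the star P_1 (which deletes B_1) and then the star B_1
--     (which deletes P_2 and B_2) expresses the count for n+2 vertices as
--     a times the count for the last n+1 vertices plus b times the count for
--     the last n vertices: the recursion of u.
module Submission where

open import Defs
open import Data.Nat using (ℕ; zero; suc; _+_; _*_; _<_; _≤_; _≡ᵇ_; z≤n; s≤s)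
open import Data.Nat.Properties
  using (+-assoc; +-suc; +-identityʳ; +-commutativeSemigroup; ≤-refl; m≤n⇒m≤1+n; <⇒≢; <-≤-trans)
open import Data.Nat.Tactic.RingSolver using (solve-∀)
open import Data.Nat.ListAction using (sum)
open import Data.Bool using (Bool; true; false; _∧_; not; T)
open import Data.Bool.Properties using (∧-assoc; ∧-identityʳ; ∧-zeroʳ; ∧-commutativeMonoid)
open import Data.List using (List; []; _∷_; _++_; map; length; replicate; concatMap; upTo; applyUpTo; filterᵇ)
open import Data.List.Properties
  using (map-upTo; length-map; length-upTo; length-replicate; ++-identityʳ; ++-assoc; filter-++; filter-all; filter-none)
open import Data.List.Relation.Unary.All using (All; []; _∷_)
import Data.List.Relation.Unary.All as All
import Data.List.Relation.Unary.All.Properties as AllP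
open import Data.List.Relation.Binary.Permutation.Propositional using (_↭_; refl; prep; swap; trans; ↭-reflexive)
open import Data.List.Relation.Binary.Permutation.Propositional.Properties using (shifts; ++⁺ˡ)
open import Data.Product using (_×_; _,_; proj₁)
open import Data.Sum using (inj₁; inj₂)
open import Data.Unit using (tt)
open import Function using (_∘_)
open import Relation.Binary.PropositionalEquality
  using (_≡_; _≢_; refl; sym; cong; cong₂; subst; module ≡-Reasoning)
  renaming (trans to ≡-trans)
open import Relation.Nullary using (yes; no)
open import Relation.Nullary.Decidable using (⌊_⌋; T?; isYes≗does; dec-true; dec-false)
open import Algebra.Bundles using (CommutativeMonoid)
import Algebra.Properties.CommutativeSemigroup as CommSemigroupProperties
open ≡-Reasoning

open CommSemigroupProperties +-commutativeSemigroup using (interchange)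
module ∧-Props = CommSemigroupProperties (CommutativeMonoid.commutativeSemigroup ∧-commutativeMonoid)

_∧'_ : {A : Set} → (A → Bool) → (A → Bool) → A → Bool
(q ∧' r) x = q x ∧ r x

indicator : Bool → ℕ
indicator true = 1
indicator false = 0

indicator-∧ : (a b : Bool) → indicator (a ∧ b) ≡ indicator a * indicator b
indicator-∧ true b = sym (+-identityʳ _)
indicator-∧ false b = refl

countᵇ-cons : {A : Set} (f : A → Bool) (x : A) (xs : List A) →
  countᵇ f (x ∷ xs) ≡ indicator (f x) + countᵇ f xs
countᵇ-cons f x xs with f x
... | true = refl
... | false = refl

countᵇ-++ : {A : Set} (f : A → Bool) (xs ys : List A) →
  countᵇ f (xs ++ ys) ≡ countᵇ f xs + countᵇ f ys
countᵇ-++ f [] ys = refl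
countᵇ-++ f (x ∷ xs) ys
  rewrite countᵇ-cons f x (xs ++ ys) | countᵇ-cons f x xs | countᵇ-++ f xs ys =
  sym (+-assoc (indicator (f x)) (countᵇ f xs) (countᵇ f ys))

countᵇ-map : {A B : Set} (f : B → Bool) (g : A → B) (xs : List A) →
  countᵇ f (map g xs) ≡ countᵇ (f ∘ g) xs
countᵇ-map f g [] = refl
countᵇ-map f g (x ∷ xs)
  rewrite countᵇ-cons f (g x) (map g xs) | countᵇ-cons (f ∘ g) x xs =
  cong (indicator (f (g x)) +_) (countᵇ-map f g xs)

countᵇ-cong : {A : Set} {f g : A → Bool} → (∀ x → f x ≡ g x) → (xs : List A) →
  countᵇ f xs ≡ countᵇ g xs
countᵇ-cong {f = f} {g} f≗g [] = refl
countᵇ-cong {f = f} {g} f≗g (x ∷ xs)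
  rewrite countᵇ-cons f x xs | countᵇ-cons g x xs | f≗g x =
  cong (indicator (g x) +_) (countᵇ-cong f≗g xs)

countᵇ-none : {A : Set} (f : A → Bool) → (∀ x → f x ≡ false) → (xs : List A) → countᵇ f xs ≡ 0
countᵇ-none f none [] = refl
countᵇ-none f none (x ∷ xs) rewrite countᵇ-cons f x xs | none x = countᵇ-none f none xs

countᵇ-subsets-∷ : {A : Set} (f : List A → Bool) (x : A) (xs : List A) →
  countᵇ f (subsets (x ∷ xs)) ≡ countᵇ f (subsets xs) + countᵇ (λ S → f (x ∷ S)) (subsets xs)
countᵇ-subsets-∷ f x xs =
  ≡-trans (countᵇ-++ f (subsets xs) (map (x ∷_) (subsets xs)))
          (cong (countᵇ f (subsets xs) +_) (countᵇ-map f (x ∷_) (subsets xs)))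

-- Part 1.  The Hosoya index counts matchings: Z sums p(G,k) over the sizes k
-- of all sub-collections, so summing out the size recovers M.

M : List Edge → ℕ
M L = countᵇ pairwiseDisjointᵇ (subsets L)

sum-zeros : (m : ℕ) → sum (applyUpTo (λ _ → 0) m) ≡ 0
sum-zeros zero = refl
sum-zeros (suc m) = sum-zeros m

sum-split : (f g h : ℕ → ℕ) → (∀ k → h k ≡ f k + g k) → (m : ℕ) →
  sum (applyUpTo h m) ≡ sum (applyUpTo f m) + sum (applyUpTo g m)
sum-split f g h split zero = refl
sum-split f g h split (suc m) = begin
  h 0 + sum (applyUpTo (h ∘ suc) m)
    ≡⟨ cong₂ _+_ (split 0) (sum-split (f ∘ suc) (g ∘ suc) (h ∘ suc) (split ∘ suc) m) ⟩
  (f 0 + g 0) + (sum (applyUpTo (f ∘ suc) m) + sum (applyUpTo (g ∘ suc) m))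
    ≡⟨ interchange (f 0) (g 0) _ _ ⟩
  (f 0 + sum (applyUpTo (f ∘ suc) m)) + (g 0 + sum (applyUpTo (g ∘ suc) m)) ∎

indicator-sum : (n m : ℕ) (b : Bool) → n < m →
  sum (applyUpTo (λ k → indicator ((n ≡ᵇ k) ∧ b)) m) ≡ indicator b
indicator-sum zero (suc m) b _ = ≡-trans (cong (indicator b +_) (sum-zeros m)) (+-identityʳ _)
indicator-sum (suc n) (suc m) b (s≤s n<m) = indicator-sum n m b n<m

count-by-size : {A : Set} (size : A → ℕ) (f : A → Bool) (m : ℕ) (xs : List A) →
  All (λ x → size x < m) xs →
  sum (applyUpTo (λ k → countᵇ (λ x → (size x ≡ᵇ k) ∧ f x) xs) m) ≡ countᵇ f xs
count-by-size size f m [] [] = sum-zeros m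
count-by-size size f m (x ∷ xs) (bound ∷ bounds) = begin
  sum (applyUpTo (λ k → countᵇ (sized k) (x ∷ xs)) m)
    ≡⟨ sum-split (λ k → indicator (sized k x)) (λ k → countᵇ (sized k) xs) _
                 (λ k → countᵇ-cons (sized k) x xs) m ⟩
  sum (applyUpTo (λ k → indicator (sized k x)) m) + sum (applyUpTo (λ k → countᵇ (sized k) xs) m)
    ≡⟨ cong₂ _+_ (indicator-sum (size x) m (f x) bound) (count-by-size size f m xs bounds) ⟩
  indicator (f x) + countᵇ f xs
    ≡⟨ sym (countᵇ-cons f x xs) ⟩
  countᵇ f (x ∷ xs) ∎
  where
  sized : ℕ → _ → Bool
  sized k y = (size y ≡ᵇ k) ∧ f y

subsets-length : {A : Set} (G : List A) → All (λ S → length S ≤ length G) (subsets G)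
subsets-length [] = z≤n ∷ []
subsets-length (x ∷ G) =
  AllP.++⁺ (All.map m≤n⇒m≤1+n (subsets-length G)) (AllP.map⁺ (All.map s≤s (subsets-length G)))

Z≡M : (G : MultiGraph) → Z G ≡ M G
Z≡M G = ≡-trans (cong sum (map-upTo (p G) (suc (length G))))
  (count-by-size length pairwiseDisjointᵇ (suc (length G)) (subsets G) (All.map s≤s (subsets-length G)))

-- Part 2.  Deletion–contraction.

Mr : (Edge → Bool) → List Edge → ℕ
Mr r L = countᵇ (λ S → allᵇ r S ∧ pairwiseDisjointᵇ S) (subsets L)

allᵇ-∧ : {A : Set} (r s : A → Bool) (S : List A) → allᵇ r S ∧ allᵇ s S ≡ allᵇ (r ∧' s) S
allᵇ-∧ r s [] = refl
allᵇ-∧ r s (x ∷ S) =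
  ≡-trans (∧-Props.interchange (r x) (allᵇ r S) (s x) (allᵇ s S)) (cong ((r x ∧ s x) ∧_) (allᵇ-∧ r s S))

allᵇ-cong : {A : Set} {r s : A → Bool} → (∀ x → r x ≡ s x) → (S : List A) → allᵇ r S ≡ allᵇ s S
allᵇ-cong r≗s [] = refl
allᵇ-cong r≗s (x ∷ S) = cong₂ _∧_ (r≗s x) (allᵇ-cong r≗s S)

allᵇ-true : {A : Set} (S : List A) → allᵇ (λ _ → true) S ≡ true
allᵇ-true [] = refl
allᵇ-true (x ∷ S) = allᵇ-true S

Mr-cong : {r s : Edge → Bool} → (∀ e → r e ≡ s e) → (L : List Edge) → Mr r L ≡ Mr s L
Mr-cong r≗s L = countᵇ-cong (λ S → cong (_∧ pairwiseDisjointᵇ S) (allᵇ-cong r≗s S)) (subsets L)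

M≡Mr-true : (L : List Edge) → M L ≡ Mr (λ _ → true) L
M≡Mr-true L = countᵇ-cong (λ S → cong (_∧ pairwiseDisjointᵇ S) (sym (allᵇ-true S))) (subsets L)

-- An admissible edge x is either unused, or used together with an admissible
-- matching of edges disjoint from x.
Mr-accept : (r : Edge → Bool) (x : Edge) (L : List Edge) → r x ≡ true →
  Mr r (x ∷ L) ≡ Mr r L + Mr (r ∧' disjointᵇ x) L
Mr-accept r x L rx =
  ≡-trans (countᵇ-subsets-∷ _ x L) (cong (Mr r L +_) (countᵇ-cong containing-x (subsets L)))
  where
  containing-x : (S : List Edge) →
    (r x ∧ allᵇ r S) ∧ (allᵇ (disjointᵇ x) S ∧ pairwiseDisjointᵇ S)
      ≡ allᵇ (r ∧' disjointᵇ x) S ∧ pairwiseDisjointᵇ S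
  containing-x S rewrite rx =
    ≡-trans (sym (∧-assoc (allᵇ r S) _ _)) (cong (_∧ pairwiseDisjointᵇ S) (allᵇ-∧ r (disjointᵇ x) S))

Mr-reject : (r : Edge → Bool) (x : Edge) (L : List Edge) → r x ≡ false → Mr r (x ∷ L) ≡ Mr r L
Mr-reject r x L rx = ≡-trans (countᵇ-subsets-∷ _ x L)
  (≡-trans (cong (Mr r L +_) (countᵇ-none _ (λ S → cong (λ c → (c ∧ allᵇ r S) ∧ _) rx) (subsets L)))
           (+-identityʳ _))

Mr-filter : (q r : Edge → Bool) (L : List Edge) → Mr r (filterᵇ q L) ≡ Mr (q ∧' r) L
Mr-filter q r [] = refl
Mr-filter q r (x ∷ L) with q x in qx
... | false = ≡-trans (Mr-filter q r L) (sym (Mr-reject (q ∧' r) x L (cong (_∧ r x) qx)))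
... | true with r x in rx
...   | false = begin
  Mr r (x ∷ filterᵇ q L)  ≡⟨ Mr-reject r x (filterᵇ q L) rx ⟩
  Mr r (filterᵇ q L)      ≡⟨ Mr-filter q r L ⟩
  Mr (q ∧' r) L           ≡⟨ sym (Mr-reject (q ∧' r) x L (cong₂ _∧_ qx rx)) ⟩
  Mr (q ∧' r) (x ∷ L)     ∎
...   | true = begin
  Mr r (x ∷ filterᵇ q L)
    ≡⟨ Mr-accept r x (filterᵇ q L) rx ⟩
  Mr r (filterᵇ q L) + Mr (r ∧' disjointᵇ x) (filterᵇ q L)
    ≡⟨ cong₂ _+_ (Mr-filter q r L) (Mr-filter q (r ∧' disjointᵇ x) L) ⟩
  Mr (q ∧' r) L + Mr (q ∧' (r ∧' disjointᵇ x)) L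
    ≡⟨ cong (Mr (q ∧' r) L +_) (Mr-cong (λ e → sym (∧-assoc (q e) (r e) _)) L) ⟩
  Mr (q ∧' r) L + Mr ((q ∧' r) ∧' disjointᵇ x) L
    ≡⟨ sym (Mr-accept (q ∧' r) x L (cong₂ _∧_ qx rx)) ⟩
  Mr (q ∧' r) (x ∷ L) ∎

-- Deletion–contraction: matchings avoiding x, plus matchings containing x.
M-∷ : (x : Edge) (F : List Edge) → M (x ∷ F) ≡ M F + M (filterᵇ (disjointᵇ x) F)
M-∷ x F = begin
  M (x ∷ F)                                        ≡⟨ countᵇ-subsets-∷ pairwiseDisjointᵇ x F ⟩
  M F + Mr (disjointᵇ x) F                         ≡⟨ cong (M F +_) (Mr-cong (λ e → sym (∧-identityʳ _)) F) ⟩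
  M F + Mr (disjointᵇ x ∧' (λ _ → true)) F         ≡⟨ cong (M F +_) (sym (Mr-filter (disjointᵇ x) _ F)) ⟩
  M F + Mr (λ _ → true) (filterᵇ (disjointᵇ x) F)  ≡⟨ cong (M F +_) (sym (M≡Mr-true (filterᵇ (disjointᵇ x) F))) ⟩
  M F + M (filterᵇ (disjointᵇ x) F)                ∎

same-vertex : (v : Vtx) → ⌊ v ≟V v ⌋ ≡ true
same-vertex v = ≡-trans (isYes≗does (v ≟V v)) (dec-true (v ≟V v) refl)

different-vertices : {v w : Vtx} → v ≢ w → ⌊ v ≟V w ⌋ ≡ false
different-vertices {v} {w} v≢w = ≡-trans (isYes≗does (v ≟V w)) (dec-false (v ≟V w) v≢w)

≟V-sym : (v w : Vtx) → ⌊ v ≟V w ⌋ ≡ ⌊ w ≟V v ⌋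
≟V-sym v w with v ≟V w
... | yes refl = sym (same-vertex v)
... | no v≢w = sym (different-vertices (v≢w ∘ sym))

disjointᵇ-sym : (e f : Edge) → disjointᵇ e f ≡ disjointᵇ f e
disjointᵇ-sym (v , w) (x , y)
  rewrite ≟V-sym x v | ≟V-sym x w | ≟V-sym y v | ≟V-sym y w =
  cong (not ⌊ v ≟V x ⌋ ∧_) (∧-Props.x∙yz≈y∙xz (not ⌊ v ≟V y ⌋) (not ⌊ w ≟V x ⌋) (not ⌊ w ≟V y ⌋))

meet-at-start : (e f : Edge) → proj₁ e ≡ proj₁ f → disjointᵇ e f ≡ false
meet-at-start (v , w) (.v , y) refl rewrite same-vertex v = refl

meet-at-end : (v w y : Vtx) → disjointᵇ (v , w) (w , y) ≡ false
meet-at-end v w y rewrite same-vertex w =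
  ≡-trans (cong (not ⌊ v ≟V w ⌋ ∧_) (∧-zeroʳ (not ⌊ v ≟V y ⌋))) (∧-zeroʳ (not ⌊ v ≟V w ⌋))

filterᵇ-all : (q : Edge → Bool) {xs : List Edge} → All (λ x → q x ≡ true) xs → filterᵇ q xs ≡ xs
filterᵇ-all q = filter-all (T? ∘ q) ∘ All.map (λ qx → subst T (sym qx) tt)

filterᵇ-none : (q : Edge → Bool) {xs : List Edge} → All (λ x → q x ≡ false) xs → filterᵇ q xs ≡ []
filterᵇ-none q = filter-none (T? ∘ q) ∘ All.map (λ qx → subst T qx)

filterᵇ-filterᵇ : {A : Set} (q r : A → Bool) (xs : List A) →
  filterᵇ r (filterᵇ q xs) ≡ filterᵇ (q ∧' r) xs
filterᵇ-filterᵇ q r [] = refl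
filterᵇ-filterᵇ q r (x ∷ xs) with q x
... | false = filterᵇ-filterᵇ q r xs
... | true with r x
...   | true = cong (x ∷_) (filterᵇ-filterᵇ q r xs)
...   | false = filterᵇ-filterᵇ q r xs

filterᵇ-cong : {A : Set} {q r : A → Bool} → (∀ x → q x ≡ r x) → (xs : List A) →
  filterᵇ q xs ≡ filterᵇ r xs
filterᵇ-cong q≗r [] = refl
filterᵇ-cong {r = r} q≗r (x ∷ xs) rewrite q≗r x with r x
... | true = cong (x ∷_) (filterᵇ-cong q≗r xs)
... | false = filterᵇ-cong q≗r xs

M-filter-∷ : (q : Edge → Bool) (x : Edge) (F : List Edge) →
  M (filterᵇ q (x ∷ F)) ≡ M (filterᵇ q F) + indicator (q x) * M (filterᵇ (q ∧' disjointᵇ x) F)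
M-filter-∷ q x F with q x
... | false = sym (+-identityʳ _)
... | true = ≡-trans (M-∷ x (filterᵇ q F))
  (cong (M (filterᵇ q F) +_) (≡-trans (cong M (filterᵇ-filterᵇ q (disjointᵇ x) F)) (sym (+-identityʳ _))))

M-filter-∷-∷ : (q : Edge → Bool) (x y : Edge) (F : List Edge) →
  M (filterᵇ q (x ∷ y ∷ F))
    ≡ (M (filterᵇ q F) + indicator (q y) * M (filterᵇ (q ∧' disjointᵇ y) F))
      + indicator (q x) * (M (filterᵇ (q ∧' disjointᵇ x) F)
                           + (indicator (q y) * indicator (disjointᵇ x y))
                             * M (filterᵇ ((q ∧' disjointᵇ x) ∧' disjointᵇ y) F))
M-filter-∷-∷ q x y F = begin
  M (filterᵇ q (x ∷ y ∷ F))
    ≡⟨ M-filter-∷ q x (y ∷ F) ⟩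
  M (filterᵇ q (y ∷ F)) + indicator (q x) * M (filterᵇ qx (y ∷ F))
    ≡⟨ cong₂ _+_ (M-filter-∷ q y F) (cong (indicator (q x) *_) (M-filter-∷ qx y F)) ⟩
  (M (filterᵇ q F) + indicator (q y) * M (filterᵇ (q ∧' disjointᵇ y) F))
    + indicator (q x) * (M (filterᵇ qx F) + indicator (q y ∧ disjointᵇ x y) * M (filterᵇ (qx ∧' disjointᵇ y) F))
    ≡⟨ cong (λ t → _ + indicator (q x) * (M (filterᵇ qx F) + t * M (filterᵇ (qx ∧' disjointᵇ y) F)))
            (indicator-∧ (q y) (disjointᵇ x y)) ⟩
  (M (filterᵇ q F) + indicator (q y) * M (filterᵇ (q ∧' disjointᵇ y) F))
    + indicator (q x) * (M (filterᵇ qx F)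
                         + (indicator (q y) * indicator (disjointᵇ x y)) * M (filterᵇ (qx ∧' disjointᵇ y) F)) ∎
  where
  qx : Edge → Bool
  qx = q ∧' disjointᵇ x

-- Two edge lists are matching-equivalent if every restriction of them has the
-- same number of matchings; quantifying over all restrictions is what lets
-- the induction over permutations go through.
_≈ᴹ_ : List Edge → List Edge → Set
xs ≈ᴹ ys = ∀ q → M (filterᵇ q xs) ≡ M (filterᵇ q ys)

≈ᴹ-∷ : (x : Edge) {xs ys : List Edge} → xs ≈ᴹ ys → (x ∷ xs) ≈ᴹ (x ∷ ys)
≈ᴹ-∷ x {xs} {ys} xs≈ys q = begin
  M (filterᵇ q (x ∷ xs))
    ≡⟨ M-filter-∷ q x xs ⟩
  M (filterᵇ q xs) + indicator (q x) * M (filterᵇ (q ∧' disjointᵇ x) xs)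
    ≡⟨ cong₂ _+_ (xs≈ys q) (cong (indicator (q x) *_) (xs≈ys (q ∧' disjointᵇ x))) ⟩
  M (filterᵇ q ys) + indicator (q x) * M (filterᵇ (q ∧' disjointᵇ x) ys)
    ≡⟨ sym (M-filter-∷ q x ys) ⟩
  M (filterᵇ q (x ∷ ys)) ∎

-- The two-edge expansion is symmetric in x and y, since disjointness is.
≈ᴹ-swap : (x y : Edge) (xs : List Edge) → (x ∷ y ∷ xs) ≈ᴹ (y ∷ x ∷ xs)
≈ᴹ-swap x y xs q = begin
  M (filterᵇ q (x ∷ y ∷ xs))
    ≡⟨ M-filter-∷-∷ q x y xs ⟩
  (M₀ + [ y ] * Mʸ) + [ x ] * (Mˣ + ([ y ] * [x,y]) * Mˣʸ)
    ≡⟨ regroup M₀ Mˣ Mʸ [ x ] [ y ] [x,y] Mˣʸ ⟩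
  (M₀ + [ x ] * Mˣ) + [ y ] * (Mʸ + ([ x ] * [x,y]) * Mˣʸ)
    ≡⟨ cong₂ (λ d c → (M₀ + [ x ] * Mˣ) + [ y ] * (Mʸ + ([ x ] * d) * c))
             (cong indicator (disjointᵇ-sym x y))
             (cong M (filterᵇ-cong (λ e → ∧-Props.xy∙z≈xz∙y (q e) (dx e) (dy e)) xs)) ⟩
  (M₀ + [ x ] * Mˣ) + [ y ] * (Mʸ + ([ x ] * indicator (disjointᵇ y x)) * M (filterᵇ ((q ∧' dy) ∧' dx) xs))
    ≡⟨ sym (M-filter-∷-∷ q y x xs) ⟩
  M (filterᵇ q (y ∷ x ∷ xs)) ∎
  where
  dx dy : Edge → Bool
  dx = disjointᵇ x
  dy = disjointᵇ y
  [_] : Edge → ℕ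
  [ e ] = indicator (q e)
  [x,y] M₀ Mˣ Mʸ Mˣʸ : ℕ
  [x,y] = indicator (disjointᵇ x y)
  M₀ = M (filterᵇ q xs)
  Mˣ = M (filterᵇ (q ∧' dx) xs)
  Mʸ = M (filterᵇ (q ∧' dy) xs)
  Mˣʸ = M (filterᵇ ((q ∧' dx) ∧' dy) xs)
  regroup : ∀ n A B i j d C → (n + j * B) + i * (A + (j * d) * C) ≡ (n + i * A) + j * (B + (i * d) * C)
  regroup = solve-∀

↭⇒≈ᴹ : {xs ys : List Edge} → xs ↭ ys → xs ≈ᴹ ys
↭⇒≈ᴹ refl q = refl
↭⇒≈ᴹ (prep x p) = ≈ᴹ-∷ x (↭⇒≈ᴹ p)
↭⇒≈ᴹ (swap {xs} x y p) q = ≡-trans (≈ᴹ-swap x y xs q) (≈ᴹ-∷ y (≈ᴹ-∷ x (↭⇒≈ᴹ p)) q)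
↭⇒≈ᴹ (trans p p′) q = ≡-trans (↭⇒≈ᴹ p q) (↭⇒≈ᴹ p′ q)

M-↭ : {xs ys : List Edge} → xs ↭ ys → M xs ≡ M ys
M-↭ {xs} {ys} p = begin
  M xs                          ≡⟨ cong M (sym (keep-all xs)) ⟩
  M (filterᵇ (λ _ → true) xs)   ≡⟨ ↭⇒≈ᴹ p (λ _ → true) ⟩
  M (filterᵇ (λ _ → true) ys)   ≡⟨ cong M (keep-all ys) ⟩
  M ys                          ∎
  where
  keep-all : (zs : List Edge) → filterᵇ (λ _ → true) zs ≡ zs
  keep-all zs = filterᵇ-all (λ _ → true) (All.universal (λ _ → refl) zs)

star : (v : Vtx) (L R R′ : List Edge) →
  All (λ e → proj₁ e ≡ v) L → All (λ e → filterᵇ (disjointᵇ e) R ≡ R′) L →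
  M (L ++ R) ≡ M R + length L * M R′
star v [] R R′ [] [] = sym (+-identityʳ (M R))
star v (e ∷ L) R R′ (e∋v ∷ L∋v) (leaves ∷ L-leaves) = begin
  M (e ∷ L ++ R)                                  ≡⟨ M-∷ e (L ++ R) ⟩
  M (L ++ R) + M (filterᵇ (disjointᵇ e) (L ++ R)) ≡⟨ cong₂ _+_ (star v L R R′ L∋v L-leaves) (cong M deleted) ⟩
  (M R + length L * M R′) + M R′                  ≡⟨ add-one (M R) (length L) (M R′) ⟩
  M R + suc (length L) * M R′                     ∎
  where
  deleted : filterᵇ (disjointᵇ e) (L ++ R) ≡ R′
  deleted = ≡-trans (filter-++ (T? ∘ disjointᵇ e) L R)
    (cong₂ _++_ (filterᵇ-none (disjointᵇ e) (All.map (λ {f} f∋v → meet-at-start e f (≡-trans e∋v (sym f∋v))) L∋v))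
                leaves)
  add-one : ∀ m k n → (m + k * n) + n ≡ m + suc k * n
  add-one = solve-∀

-- Part 4.  The caterpillar.

position : Vtx → ℕ
position (inj₁ k) = k
position (inj₂ (k , _)) = k

Beyond : ℕ → Edge → Set
Beyond t (v , w) = (t ≤ position v) × (t ≤ position w)

apart : {t : ℕ} (z z′ : Vtx) → position z < t → t ≤ position z′ → ⌊ z ≟V z′ ⌋ ≡ false
apart z z′ z<t t≤z′ = different-vertices (λ z≡z′ → <⇒≢ (<-≤-trans z<t t≤z′) (cong position z≡z′))

separated : (v w : Vtx) (t : ℕ) (f : Edge) → position v < t → position w < t → Beyond t f →
  disjointᵇ (v , w) f ≡ true
separated v w t (x , y) v<t w<t (t≤x , t≤y)
  rewrite apart v x v<t t≤x | apart v y v<t t≤y | apart w x w<t t≤x | apart w y w<t t≤y = refl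

interval : ℕ → ℕ → List ℕ
interval s zero = []
interval s (suc m) = s ∷ interval (suc s) m

applyUpTo-interval : (f : ℕ → ℕ) (s m : ℕ) → (∀ i → f i ≡ s + i) → applyUpTo f m ≡ interval s m
applyUpTo-interval f s zero shift = refl
applyUpTo-interval f s (suc m) shift =
  cong₂ _∷_ (≡-trans (shift 0) (+-identityʳ s))
            (applyUpTo-interval (f ∘ suc) (suc s) m (λ i → ≡-trans (shift (suc i)) (+-suc s i)))

range1≡interval : (m : ℕ) → range1 m ≡ interval 1 m
range1≡interval m = ≡-trans (map-upTo suc m) (applyUpTo-interval suc 1 m (λ i → refl))

-- The caterpillar with a = 1 + a′ and b bonds between consecutive vertices.
module Caterpillar (a′ b : ℕ) where

  pendant : ℕ → ℕ → Edge
  pendant s j = (inj₁ s , inj₂ (s , j))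

  pendants : ℕ → List Edge
  pendants s = map (pendant s) (range1 a′)

  bond : ℕ → Edge
  bond s = (inj₁ s , inj₁ (suc s))

  bonds : ℕ → List Edge
  bonds s = replicate b (bond s)

  caterpillar : ℕ → ℕ → List Edge
  caterpillar s zero = []
  caterpillar s (suc zero) = pendants s
  caterpillar s (suc (suc n)) = pendants s ++ bonds s ++ caterpillar (suc s) (suc n)

  length-pendants : (s : ℕ) → length (pendants s) ≡ a′
  length-pendants s =
    ≡-trans (length-map (pendant s) (range1 a′)) (≡-trans (length-map suc (upTo a′)) (length-upTo a′))

  pendants-at : (s : ℕ) → All (λ e → proj₁ e ≡ inj₁ s) (pendants s)
  pendants-at s = AllP.map⁺ (All.universal (λ _ → refl) (range1 a′))

  bonds-at : (s : ℕ) → All (λ e → proj₁ e ≡ inj₁ s) (bonds s)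
  bonds-at s = AllP.replicate⁺ b refl

  D≡blocks : (k : ℕ) → D (suc k) (λ _ → suc a′) (λ _ → b)
    ≡ concatMap bonds (interval 1 k) ++ concatMap pendants (interval 1 (suc k))
  D≡blocks k = cong₂ _++_ (cong (concatMap bonds) (range1≡interval k))
                          (cong (concatMap pendants) (range1≡interval (suc k)))

  blocks↭caterpillar : (s n : ℕ) →
    concatMap bonds (interval s n) ++ concatMap pendants (interval s (suc n)) ↭ caterpillar s (suc n)
  blocks↭caterpillar s zero = ↭-reflexive (++-identityʳ (pendants s))
  blocks↭caterpillar s (suc n) =
    trans (shifts (bonds s ++ B) (pendants s) {P})
          (++⁺ˡ (pendants s) (trans (↭-reflexive (++-assoc (bonds s) B P))
                                    (++⁺ˡ (bonds s) (blocks↭caterpillar (suc s) n))))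
    where
    B P : List Edge
    B = concatMap bonds (interval (suc s) n)
    P = concatMap pendants (interval (suc s) (suc n))

  beyond-pendants : {t s : ℕ} → t ≤ s → All (Beyond t) (pendants s)
  beyond-pendants t≤s = AllP.map⁺ (All.universal (λ _ → t≤s , t≤s) (range1 a′))

  beyond-bonds : {t s : ℕ} → t ≤ s → All (Beyond t) (bonds s)
  beyond-bonds t≤s = AllP.replicate⁺ b (t≤s , m≤n⇒m≤1+n t≤s)

  beyond-caterpillar : {t : ℕ} (s n : ℕ) → t ≤ s → All (Beyond t) (caterpillar s n)
  beyond-caterpillar s zero t≤s = []
  beyond-caterpillar s (suc zero) t≤s = beyond-pendants t≤s
  beyond-caterpillar s (suc (suc n)) t≤s =
    AllP.++⁺ (beyond-pendants t≤s)
             (AllP.++⁺ (beyond-bonds t≤s) (beyond-caterpillar (suc s) (suc n) (m≤n⇒m≤1+n t≤s)))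

  delete-pendant : (s j n : ℕ) →
    filterᵇ (disjointᵇ (pendant s j)) (bonds s ++ caterpillar (suc s) n) ≡ caterpillar (suc s) n
  delete-pendant s j n = ≡-trans (filter-++ (T? ∘ q) (bonds s) (caterpillar (suc s) n))
    (cong₂ _++_ (filterᵇ-none q (AllP.replicate⁺ b (meet-at-start (pendant s j) (bond s) refl)))
                (filterᵇ-all q (All.map (λ {f} → separated (inj₁ s) (inj₂ (s , j)) (suc s) f ≤-refl ≤-refl)
                                        (beyond-caterpillar (suc s) n ≤-refl))))
    where
    q : Edge → Bool
    q = disjointᵇ (pendant s j)

  bond-meets-pendants : (s : ℕ) → All (λ e → disjointᵇ (bond s) e ≡ false) (pendants (suc s))
  bond-meets-pendants s =
    AllP.map⁺ (All.universal (λ j → meet-at-end (inj₁ s) (inj₁ (suc s)) (inj₂ (suc s , j))) (range1 a′))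

  bond-meets-bonds : (s : ℕ) → All (λ e → disjointᵇ (bond s) e ≡ false) (bonds (suc s))
  bond-meets-bonds s = AllP.replicate⁺ b (meet-at-end (inj₁ s) (inj₁ (suc s)) (inj₁ (suc (suc s))))

  delete-bond : (s n : ℕ) →
    filterᵇ (disjointᵇ (bond s)) (caterpillar (suc s) (suc n)) ≡ caterpillar (suc (suc s)) n
  delete-bond s zero = filterᵇ-none (disjointᵇ (bond s)) (bond-meets-pendants s)
  delete-bond s (suc n) = begin
    filterᵇ q (pendants (suc s) ++ bonds (suc s) ++ rest)
      ≡⟨ filter-++ (T? ∘ q) (pendants (suc s)) (bonds (suc s) ++ rest) ⟩
    filterᵇ q (pendants (suc s)) ++ filterᵇ q (bonds (suc s) ++ rest)
      ≡⟨ cong (filterᵇ q (pendants (suc s)) ++_) (filter-++ (T? ∘ q) (bonds (suc s)) rest) ⟩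
    filterᵇ q (pendants (suc s)) ++ filterᵇ q (bonds (suc s)) ++ filterᵇ q rest
      ≡⟨ cong₂ _++_ (filterᵇ-none q (bond-meets-pendants s))
                    (cong₂ _++_ (filterᵇ-none q (bond-meets-bonds s)) (filterᵇ-all q rest-survives)) ⟩
    rest ∎
    where
    q : Edge → Bool
    q = disjointᵇ (bond s)
    rest : List Edge
    rest = caterpillar (suc (suc s)) (suc n)
    rest-survives : All (λ e → q e ≡ true) rest
    rest-survives = All.map (λ {f} → separated (inj₁ s) (inj₁ (suc s)) (suc (suc s)) f (m≤n⇒m≤1+n ≤-refl) ≤-refl)
                            (beyond-caterpillar (suc (suc s)) (suc n) ≤-refl)

  -- The caterpillar on n vertices has u_{n+1} matchings: peel off the star of
  -- pendant edges at the first vertex, then the star of bonds.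
  matchings-caterpillar : (n s : ℕ) → M (caterpillar s n) ≡ u (suc a′) b (suc n)
  matchings-caterpillar zero s = refl
  matchings-caterpillar (suc zero) s = begin
    M (pendants s)               ≡⟨ cong M (sym (++-identityʳ (pendants s))) ⟩
    M (pendants s ++ [])         ≡⟨ star (inj₁ s) (pendants s) [] [] (pendants-at s)
                                         (All.universal (λ _ → refl) (pendants s)) ⟩
    1 + length (pendants s) * 1  ≡⟨ cong (λ k → 1 + k * 1) (length-pendants s) ⟩
    1 + a′ * 1                   ≡⟨ base a′ b ⟩
    suc a′ * 1 + b * 0           ∎
    where
    base : ∀ a′ b → 1 + a′ * 1 ≡ suc a′ * 1 + b * 0
    base = solve-∀
  matchings-caterpillar (suc (suc n)) s = begin
    M (pendants s ++ bonds s ++ E₁)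
      ≡⟨ star (inj₁ s) (pendants s) (bonds s ++ E₁) E₁ (pendants-at s)
              (AllP.map⁺ (All.universal (λ j → delete-pendant s j (suc n)) (range1 a′))) ⟩
    M (bonds s ++ E₁) + length (pendants s) * M E₁
      ≡⟨ cong₂ _+_ (star (inj₁ s) (bonds s) E₁ E₂ (bonds-at s) (AllP.replicate⁺ b (delete-bond s n)))
                   (cong (_* M E₁) (length-pendants s)) ⟩
    (M E₁ + length (bonds s) * M E₂) + a′ * M E₁
      ≡⟨ cong₂ (λ ℓ m₂ → (M E₁ + ℓ * m₂) + a′ * M E₁)
               (length-replicate b) (matchings-caterpillar n (suc (suc s))) ⟩
    (M E₁ + b * uₙ) + a′ * M E₁
      ≡⟨ cong (λ m₁ → (m₁ + b * uₙ) + a′ * m₁) (matchings-caterpillar (suc n) (suc s)) ⟩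
    (uₙ₊₁ + b * uₙ) + a′ * uₙ₊₁
      ≡⟨ recurrence uₙ₊₁ uₙ a′ b ⟩
    suc a′ * uₙ₊₁ + b * uₙ ∎
    where
    E₁ E₂ : List Edge
    E₁ = caterpillar (suc s) (suc n)
    E₂ = caterpillar (suc (suc s)) n
    uₙ uₙ₊₁ : ℕ
    uₙ = u (suc a′) b (suc n)
    uₙ₊₁ = u (suc a′) b (suc (suc n))
    recurrence : ∀ x y a′ b → (x + b * y) + a′ * x ≡ suc a′ * x + b * y
    recurrence = solve-∀

corollary1 : (a b : ℕ) → 0 < a → 0 < b → (n : ℕ) → 0 < n →
    Z (D n (λ _ → a) (λ _ → b)) ≡ u a b (suc n)
corollary1 (suc a′) b _ _ (suc k) _ = begin
  Z (D (suc k) (λ _ → suc a′) (λ _ → b))   ≡⟨ Z≡M (D (suc k) (λ _ → suc a′) (λ _ → b)) ⟩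
  M (D (suc k) (λ _ → suc a′) (λ _ → b))   ≡⟨ cong M (D≡blocks k) ⟩
  M (concatMap bonds (interval 1 k) ++ concatMap pendants (interval 1 (suc k)))
                                            ≡⟨ M-↭ (blocks↭caterpillar 1 k) ⟩
  M (caterpillar 1 (suc k))                 ≡⟨ matchings-caterpillar (suc k) 1 ⟩
  u (suc a′) b (suc (suc k))                ∎
  where open Caterpillar a′ b
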